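{- Let $R$ be a finite local ring with maximal ideal $M$. If $|R|/|M|$ is odd, then $\mathcal{G}_{R}\cong\mathcal{G}_{R/M}\otimes\mathring{K}_{|M|}$.
   Context: All rings are finite commutative rings with identity $1\neq 0$. A local ring is a commutative ring with a unique maximal ideal. For a finite commutative ring $R$, let $R^\times$ be its group of units, $Q_R=\{u^2: u\in R^\times\}$ and $T_R=Q_R\cup(-Q_R)$. The quadratic unitary Cayley graph $\mathcal{G}_R$ is the graph with vertex set $R$ in which $x,y\in R$ are adjacent iff $x-y\in T_R$. $\mathring{K}_n$ denotes the complete pseudograph on $n$ vertices: the complete graph $K_n$ with a loop attached at every vertex. The tensor product $G\otimes H$ of two graphs or pseudographs has vertex set $V(G)\times V(H)$, with $(u,v)$ adjacent to $(x,y)$ iff $u$ is adjacent to $x$ in $G$ and $v$ is adjacent to $y$ in $H$. -}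

module Defs where

open import Level using (Level; _⊔_; suc)
open import Algebra.Bundles using (CommutativeRing)
open import Data.Nat.Base using (ℕ) renaming (_+_ to _+ℕ_; _*_ to _*ℕ_)
open import Data.Fin.Base using (Fin)
open import Data.Product.Base using (Σ; ∃; _×_; _,_; proj₁; proj₂)
open import Data.Sum.Base using (_⊎_)
open import Data.Unit.Polymorphic using (⊤)
open import Data.Product.Relation.Binary.Pointwise.NonDependent using (×-setoid)
open import Relation.Nullary using (¬_)
open import Relation.Binary.Bundles using (Setoid)
open import Relation.Binary.Core using (Rel)
import Relation.Binary.PropositionalEquality as ≡
open import Function.Bundles using (Inverse; _⇔_)

Odd : ℕ → Set
Odd k = ∃ λ j → k ≡.≡ 1 +ℕ 2 *ℕ j

record Graph (v e a : Level) : Set (suc (v ⊔ e ⊔ a)) where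
  field
    V   : Setoid v e
    Adj : Rel (Setoid.Carrier V) a

open Graph public

_≅_ : ∀ {v₁ e₁ a₁ v₂ e₂ a₂} → Graph v₁ e₁ a₁ → Graph v₂ e₂ a₂ →
      Set (v₁ ⊔ e₁ ⊔ a₁ ⊔ v₂ ⊔ e₂ ⊔ a₂)
G ≅ H = Σ (Inverse (V G) (V H)) λ φ →
          ∀ x y → Adj G x y ⇔ Adj H (Inverse.to φ x) (Inverse.to φ y)

_⊗_ : ∀ {v₁ e₁ a₁ v₂ e₂ a₂} → Graph v₁ e₁ a₁ → Graph v₂ e₂ a₂ →
      Graph (v₁ ⊔ v₂) (e₁ ⊔ e₂) (a₁ ⊔ a₂)
G ⊗ H = record
  { V   = ×-setoid (V G) (V H)
  ; Adj = λ { (u , v) (x , y) → Adj G u x × Adj H v y } }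

K̊ : ℕ → Graph Level.zero Level.zero Level.zero
K̊ n = record { V = ≡.setoid (Fin n) ; Adj = λ _ _ → ⊤ }

module _ {c ℓ} (R : CommutativeRing c ℓ) where
  open CommutativeRing R

  IsUnit : Carrier → Set (c ⊔ ℓ)
  IsUnit u = ∃ λ w → u * w ≈ 1#

  InT : Carrier → Set (c ⊔ ℓ)
  InT z = ∃ λ u → IsUnit u × (z ≈ u * u ⊎ z ≈ - (u * u))

  QUCG : Graph c ℓ (c ⊔ ℓ)
  QUCG = record { V = setoid ; Adj = λ x y → InT (x - y) }

  record IsIdeal (I : Carrier → Set ℓ) : Set (c ⊔ ℓ) where
    field
      resp   : ∀ {x y} → x ≈ y → I x → I y
      zero∈  : I 0#
      +-closed : ∀ {x y} → I x → I y → I (x + y)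
      neg-closed : ∀ {x} → I x → I (- x)
      *-closed : ∀ r {x} → I x → I (r * x)

  IsMaximalIdeal : (Carrier → Set ℓ) → Set (c ⊔ suc ℓ)
  IsMaximalIdeal M =
    IsIdeal M × ¬ M 1# ×
    (∀ (J : Carrier → Set ℓ) → IsIdeal J → (∀ x → M x → J x) →
       (∀ x → J x → M x) ⊎ (∀ x → J x))

  IsLocalWithMaximal : (Carrier → Set ℓ) → Set (c ⊔ suc ℓ)
  IsLocalWithMaximal M =
    IsMaximalIdeal M × (∀ J → IsMaximalIdeal J → ∀ x → J x ⇔ M x)

  HasCard : ℕ → Set (c ⊔ ℓ)
  HasCard n = Inverse (≡.setoid (Fin n)) setoid

  SubSetoid : (Carrier → Set ℓ) → Setoid (c ⊔ ℓ) ℓ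
  SubSetoid M = record
    { Carrier = Σ Carrier M
    ; _≈_ = λ a b → proj₁ a ≈ proj₁ b
    ; isEquivalence = record { refl = refl ; sym = sym ; trans = trans } }

  SubsetHasCard : (Carrier → Set ℓ) → ℕ → Set (c ⊔ ℓ)
  SubsetHasCard M m = Inverse (≡.setoid (Fin m)) (SubSetoid M)

module Quotient {c ℓ} (R : CommutativeRing c ℓ) (M : CommutativeRing.Carrier R → Set ℓ)
                (isIdeal : IsIdeal R M) where
  open IsIdeal isIdeal
  import Algebra.Properties.AbelianGroup
  import Algebra.Properties.CommutativeSemigroup
  open CommutativeRing R using (Carrier; _+_; _*_; -_; 0#; 1#; _≈_)
  module R = CommutativeRing R
  module AG = Algebra.Properties.AbelianGroup R.+-abelianGroup
  module CS = Algebra.Properties.CommutativeSemigroup R.+-commutativeSemigroup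

  l-+ : ∀ x y u v → (x + u) + - (y + v) ≈ (x + - y) + (u + - v)
  l-+ x y u v = R.trans (R.+-congˡ (R.sym (AG.⁻¹-∙-comm y v))) (CS.interchange x u (- y) (- v))

  l-sym : ∀ x y → y + - x ≈ - (x + - y)
  l-sym x y = R.sym (R.trans (AG.⁻¹-anti-homo-∙ x (- y)) (R.+-congʳ (AG.⁻¹-involutive y)))

  l-trans : ∀ x y z → x + - z ≈ (x + - y) + (y + - z)
  l-trans x y z = R.sym (R.trans (R.+-assoc x (- y) (y + - z))
    (R.+-congˡ (R.trans (R.sym (R.+-assoc (- y) y (- z)))
      (R.trans (R.+-congʳ (proj₁ R.-‿inverse y)) (proj₁ R.+-identity (- z))))))

  l-neg : ∀ x y → (- x) + - (- y) ≈ - (x + - y)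
  l-neg x y = AG.⁻¹-∙-comm x (- y)
  import Algebra.Properties.Ring R.ring as RP

  infix 4 _∼_
  _∼_ : Carrier → Carrier → Set ℓ
  x ∼ y = M (x + - y)

  lift : ∀ {x y} → x ≈ y → x ∼ y
  lift {x} {y} x≈y = resp (R.sym (R.trans (R.+-congʳ x≈y) (R.-‿inverseʳ y))) zero∈

  ∼-refl : ∀ {x} → x ∼ x
  ∼-refl = lift R.refl

  ∼-sym : ∀ {x y} → x ∼ y → y ∼ x
  ∼-sym {x} {y} p = resp (R.sym (l-sym x y)) (neg-closed p)

  ∼-trans : ∀ {x y z} → x ∼ y → y ∼ z → x ∼ z
  ∼-trans {x} {y} {z} p q = resp (R.sym (l-trans x y z)) (+-closed p q)

  +-cong∼ : ∀ {x y u v} → x ∼ y → u ∼ v → (x + u) ∼ (y + v)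
  +-cong∼ {x} {y} {u} {v} p q = resp (R.sym (l-+ x y u v)) (+-closed p q)

  *-cong∼ : ∀ {x y u v} → x ∼ y → u ∼ v → (x * u) ∼ (y * v)
  *-cong∼ {x} {y} {u} {v} p q = ∼-trans {y = x * v}
    (resp (RP.x[y-z]≈xy-xz x u v) (*-closed x q))
    (resp (R.trans (R.*-comm v (x + - y)) (RP.[y-z]x≈yx-zx v x y)) (*-closed v p))

  neg-cong∼ : ∀ {x y} → x ∼ y → (- x) ∼ (- y)
  neg-cong∼ {x} {y} p = resp (R.sym (l-neg x y)) (neg-closed p)

  R/M : CommutativeRing c ℓ
  R/M = record
    { Carrier = Carrier
    ; _≈_ = _∼_
    ; _+_ = _+_
    ; _*_ = _*_
    ; -_ = -_
    ; 0# = 0#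
    ; 1# = 1#
    ; isCommutativeRing = record
      { isRing = record
        { +-isAbelianGroup = record
          { isGroup = record
            { isMonoid = record
              { isSemigroup = record
                { isMagma = record
                  { isEquivalence = record { refl = ∼-refl ; sym = ∼-sym ; trans = ∼-trans }
                  ; ∙-cong = +-cong∼ }
                ; assoc = λ x y z → lift (R.+-assoc x y z) }
              ; identity = (λ x → lift (proj₁ R.+-identity x)) , (λ x → lift (proj₂ R.+-identity x)) }
            ; inverse = (λ x → lift (proj₁ R.-‿inverse x)) , (λ x → lift (proj₂ R.-‿inverse x))
            ; ⁻¹-cong = neg-cong∼ }
          ; comm = λ x y → lift (R.+-comm x y) }
        ; *-cong = *-cong∼
        ; *-assoc = λ x y z → lift (R.*-assoc x y z)
        ; *-identity = (λ x → lift (proj₁ R.*-identity x)) , (λ x → lift (proj₂ R.*-identity x))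
        ; distrib = (λ x y z → lift (proj₁ R.distrib x y z)) , (λ x y z → lift (proj₂ R.distrib x y z)) }
      ; *-comm = λ x y → lift (R.*-comm x y) } }

module Submission where

-- The isomorphism 𝒢_R ≅ 𝒢_{R/M} ⊗ K̊_m is the map
-- x ↦ (x mod M , x - rep x), where rep picks a representative of each
-- class modulo M; it is a bijection R ≅ R/M × M, and it preserves
-- adjacency once we know that x - y ∈ T_R iff x - y ∈ T_{R/M}.
--
-- The
-- hypothesis that k = |R/M| is odd gives 2 ∉ M: otherwise x ↦ x + 1 would
-- be a fixed-point-free involution of R/M.

open import Algebra.Bundles using (CommutativeRing; RawRing)
import Algebra.Solver.Ring.AlmostCommutativeRing as ACR
open import Data.Bool.Base using (Bool; if_then_else_)
open import Data.Empty using (⊥-elim)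
open import Data.Fin.Base using (Fin; zero; suc; toℕ; punchOut)
open import Data.Fin.Permutation using (permutation; ↔⇒≡)
open import Data.Fin.Properties using (toℕ-injective; any?; _≟_; injective⇒≤; punchOut-injective; *↔×; nonZeroIndex)
open import Data.Maybe.Base as Maybe using (Maybe; just; nothing; fromMaybe)
open import Data.Nat.Base as ℕ using (ℕ; zero; suc; _<ᵇ_)
import Data.Nat.Properties as ℕ
open import Algebra.Properties.CommutativeMonoid.Sum ℕ.+-0-commutativeMonoid using (sum; sum-permute; ∑-distrib-+; sum-cong-≗)
open import Data.Product.Base using (Σ; ∃; _×_; _,_; proj₁; proj₂)
open import Data.Product.Function.NonDependent.Setoid using (_×-inverse_)
open import Data.Product.Relation.Binary.Pointwise.NonDependent using (_×ₛ_; Pointwise-≡↔≡)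
open import Data.Sum.Base as Sum using (_⊎_; inj₁; inj₂)
open import Defs
open import Function.Base using (id; _∘_)
open import Function.Bundles using (Inverse; Equivalence; mk⇔)
import Function.Construct.Composition as Compose
import Function.Construct.Identity as Identity
import Function.Construct.Symmetry as Symmetry
open import Level using (_⊔_)
open import Relation.Binary.Bundles using (Setoid)
open import Relation.Binary.Core using (Rel)
open import Relation.Binary.Definitions using () renaming (Decidable to Decidable₂)
open import Relation.Binary.PropositionalEquality as ≡ using (_≡_; _≢_)
open import Relation.Binary.Structures using (IsEquivalence)
open import Relation.Nullary using (¬_; yes; no)
open import Relation.Nullary.Decidable.Core using (fromSum)
open import Relation.Unary using (Decidable)

-- The coefficients are
-- pairs (a , b) of naturals, standing for the integer a - b; equality of
-- coefficients is decided by comparing a + d with c + b.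
module CommutativeRingSolver {c ℓ} (R : CommutativeRing c ℓ) where
  open CommutativeRing R
  import Algebra.Properties.Ring ring as RingProps
  import Algebra.Properties.AbelianGroup +-abelianGroup as GroupProps
  import Algebra.Properties.CommutativeSemigroup +-commutativeSemigroup as SemigroupProps
  import Algebra.Properties.Semiring.Mult.TCOptimised semiring as Mult
  open import Relation.Binary.Reasoning.Setoid setoid

  Differences : RawRing _ _
  Differences = record
    { Carrier = ℕ × ℕ ; _≈_ = _≡_
    ; _+_ = λ { (a , b) (c , d) → (a ℕ.+ c , b ℕ.+ d) }
    ; _*_ = λ { (a , b) (c , d) → (a ℕ.* c ℕ.+ b ℕ.* d , a ℕ.* d ℕ.+ b ℕ.* c) }
    ; -_ = λ { (a , b) → (b , a) }
    ; 0# = (0 , 0) ; 1# = (1 , 0) }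

  ι : ℕ → Carrier
  ι k = k Mult.× 1#

  -- The interpretation of a coefficient; a positive coefficient is sent
  -- to ι a itself, so that 0 and 1 are interpreted definitionally.
  ⟦_⟧ᶜ : ℕ × ℕ → Carrier
  ⟦ a , 0 ⟧ᶜ = ι a
  ⟦ a , ℕ.suc b ⟧ᶜ = ι a - ι (ℕ.suc b)

  ⟦⟧ᶜ-diff : ∀ a b → ⟦ a , b ⟧ᶜ ≈ ι a - ι b
  ⟦⟧ᶜ-diff a 0 = sym (trans (+-congˡ RingProps.-0#≈0#) (+-identityʳ _))
  ⟦⟧ᶜ-diff a (ℕ.suc b) = refl

  +-diff : ∀ a b c d → (a + c) - (b + d) ≈ (a - b) + (c - d)
  +-diff a b c d = begin
    (a + c) + - (b + d)   ≈⟨ +-congˡ (sym (GroupProps.⁻¹-∙-comm b d)) ⟩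
    (a + c) + (- b + - d) ≈⟨ SemigroupProps.interchange a c (- b) (- d) ⟩
    (a - b) + (c - d)     ∎

  diff-cancel : ∀ x y z → (x + z) - (y + z) ≈ x - y
  diff-cancel x y z = begin
    (x + z) - (y + z)   ≈⟨ +-diff x y z z ⟩
    (x - y) + (z - z)   ≈⟨ +-congˡ (-‿inverseʳ z) ⟩
    (x - y) + 0#        ≈⟨ +-identityʳ _ ⟩
    x - y               ∎

  *-diff : ∀ a b c d → (a - b) * (c - d) ≈ (a * c + b * d) - (a * d + b * c)
  *-diff a b c d = begin
    (a - b) * (c - d)                   ≈⟨ RingProps.[y-z]x≈yx-zx (c - d) a b ⟩
    a * (c - d) - b * (c - d)           ≈⟨ +-cong (RingProps.x[y-z]≈xy-xz a c d) (-‿cong (RingProps.x[y-z]≈xy-xz b c d)) ⟩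
    (a * c - a * d) + - (b * c - b * d) ≈⟨ +-congˡ (GroupProps.⁻¹-anti-homo‿- (b * c) (b * d)) ⟩
    (a * c - a * d) + (b * d - b * c)   ≈⟨ SemigroupProps.interchange (a * c) (- (a * d)) (b * d) (- (b * c)) ⟩
    (a * c + b * d) + (- (a * d) + - (b * c)) ≈⟨ +-congˡ (GroupProps.⁻¹-∙-comm (a * d) (b * c)) ⟩
    (a * c + b * d) - (a * d + b * c)   ∎

  ι-+ : ∀ a b → ι (a ℕ.+ b) ≈ ι a + ι b
  ι-+ a b = Mult.×-homo-+ 1# a b

  homomorphism : Differences ACR.-Raw-AlmostCommutative⟶ ACR.fromCommutativeRing R
  homomorphism = record
    { ⟦_⟧ = ⟦_⟧ᶜ
    ; +-homo = λ { (a , b) (c , d) → begin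
        ⟦ a ℕ.+ c , b ℕ.+ d ⟧ᶜ           ≈⟨ ⟦⟧ᶜ-diff (a ℕ.+ c) (b ℕ.+ d) ⟩
        ι (a ℕ.+ c) - ι (b ℕ.+ d)        ≈⟨ +-cong (ι-+ a c) (-‿cong (ι-+ b d)) ⟩
        (ι a + ι c) - (ι b + ι d)        ≈⟨ +-diff _ _ _ _ ⟩
        (ι a - ι b) + (ι c - ι d)        ≈⟨ +-cong (⟦⟧ᶜ-diff a b) (⟦⟧ᶜ-diff c d) ⟨
        ⟦ a , b ⟧ᶜ + ⟦ c , d ⟧ᶜ           ∎ }
    ; *-homo = λ { (a , b) (c , d) → begin
        ⟦ a ℕ.* c ℕ.+ b ℕ.* d , a ℕ.* d ℕ.+ b ℕ.* c ⟧ᶜ      ≈⟨ ⟦⟧ᶜ-diff (a ℕ.* c ℕ.+ b ℕ.* d) (a ℕ.* d ℕ.+ b ℕ.* c) ⟩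
        ι (a ℕ.* c ℕ.+ b ℕ.* d) - ι (a ℕ.* d ℕ.+ b ℕ.* c)    ≈⟨ +-cong (ι-bilinear a c b d) (-‿cong (ι-bilinear a d b c)) ⟩
        (ι a * ι c + ι b * ι d) - (ι a * ι d + ι b * ι c)    ≈⟨ *-diff _ _ _ _ ⟨
        (ι a - ι b) * (ι c - ι d)                             ≈⟨ *-cong (⟦⟧ᶜ-diff a b) (⟦⟧ᶜ-diff c d) ⟨
        ⟦ a , b ⟧ᶜ * ⟦ c , d ⟧ᶜ                                ∎ }
    ; -‿homo = λ { (a , b) → begin
        ⟦ b , a ⟧ᶜ          ≈⟨ ⟦⟧ᶜ-diff b a ⟩
        ι b - ι a          ≈⟨ GroupProps.⁻¹-anti-homo‿- (ι a) (ι b) ⟨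
        - (ι a - ι b)      ≈⟨ -‿cong (⟦⟧ᶜ-diff a b) ⟨
        - ⟦ a , b ⟧ᶜ        ∎ }
    ; 0-homo = refl
    ; 1-homo = refl }
    where
    ι-bilinear : ∀ a c b d → ι (a ℕ.* c ℕ.+ b ℕ.* d) ≈ ι a * ι c + ι b * ι d
    ι-bilinear a c b d = trans (ι-+ (a ℕ.* c) (b ℕ.* d)) (+-cong (Mult.×1-homo-* a c) (Mult.×1-homo-* b d))

  decide : ∀ p q → Maybe (⟦ p ⟧ᶜ ≈ ⟦ q ⟧ᶜ)
  decide (a , b) (c , d) with a ℕ.+ d ℕ.≟ c ℕ.+ b
  ... | no _ = nothing
  ... | yes a+d≡c+b = just (begin
    ⟦ a , b ⟧ᶜ                  ≈⟨ ⟦⟧ᶜ-diff a b ⟩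
    ι a - ι b                   ≈⟨ diff-cancel (ι a) (ι b) (ι d) ⟨
    (ι a + ι d) - (ι b + ι d)   ≈⟨ +-cong (same-sum a d c b a+d≡c+b) (-‿cong (+-comm (ι b) (ι d))) ⟩
    (ι c + ι b) - (ι d + ι b)   ≈⟨ diff-cancel (ι c) (ι d) (ι b) ⟩
    ι c - ι d                   ≈⟨ ⟦⟧ᶜ-diff c d ⟨
    ⟦ c , d ⟧ᶜ                  ∎)
    where
    same-sum : ∀ a d c b → a ℕ.+ d ≡ c ℕ.+ b → ι a + ι d ≈ ι c + ι b
    same-sum a d c b eq = trans (sym (ι-+ a d)) (trans (reflexive (≡.cong ι eq)) (ι-+ c b))

  open import Algebra.Solver.Ring Differences (ACR.fromCommutativeRing R) homomorphism decide public

firstIndex : ∀ {k p} {P : Fin k → Set p} → Decidable P → Maybe (Fin k)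
firstIndex {zero} P? = nothing
firstIndex {suc k} P? with P? zero
... | yes _ = just zero
... | no _ = Maybe.map suc (firstIndex (P? ∘ suc))

firstIndex-sound : ∀ {k p} {P : Fin k → Set p} (P? : Decidable P) i → firstIndex P? ≡ just i → P i
firstIndex-sound {suc k} P? i eq with P? zero
firstIndex-sound {suc k} P? zero ≡.refl | yes p₀ = p₀
... | no _ with firstIndex (P? ∘ suc) in eq′
firstIndex-sound {suc k} P? (suc i) ≡.refl | no _ | just j = firstIndex-sound (P? ∘ suc) j eq′

firstIndex-complete : ∀ {k p} {P : Fin k → Set p} (P? : Decidable P) i → P i →
  ∃ λ j → firstIndex P? ≡ just j
firstIndex-complete {suc k} P? i pᵢ with P? zero
... | yes _ = zero , ≡.refl
firstIndex-complete {suc k} P? zero p₀ | no ¬p₀ = ⊥-elim (¬p₀ p₀)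
firstIndex-complete {suc k} P? (suc i) pᵢ | no _ =
  let (j , eq) = firstIndex-complete (P? ∘ suc) i pᵢ in suc j , ≡.cong (Maybe.map suc) eq

firstIndex-cong : ∀ {k p q} {P : Fin k → Set p} {Q : Fin k → Set q} (P? : Decidable P) (Q? : Decidable Q) →
  (∀ i → P i → Q i) → (∀ i → Q i → P i) → firstIndex P? ≡ firstIndex Q?
firstIndex-cong {zero} P? Q? P⇒Q Q⇒P = ≡.refl
firstIndex-cong {suc k} P? Q? P⇒Q Q⇒P with P? zero | Q? zero
... | yes _ | yes _ = ≡.refl
... | yes p₀ | no ¬q₀ = ⊥-elim (¬q₀ (P⇒Q zero p₀))
... | no ¬p₀ | yes q₀ = ⊥-elim (¬p₀ (Q⇒P zero q₀))
... | no _ | no _ = ≡.cong (Maybe.map suc) (firstIndex-cong (P? ∘ suc) (Q? ∘ suc) (P⇒Q ∘ suc) (Q⇒P ∘ suc))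

record Enumeration {n} (P : Fin n → Set) : Set where
  field
    size          : ℕ
    element       : Fin size → Fin n
    element-valid : ∀ j → P (element j)
    index         : ∀ i → P i → Fin size
    element-index : ∀ i p → element (index i p) ≡ i
    index-element : ∀ j p → index (element j) p ≡ j

  index-unique : ∀ i j p → i ≡ element j → index i p ≡ j
  index-unique .(element j) j p ≡.refl = index-element j p

enumerate : ∀ {n} (P : Fin n → Set) → Decidable P → Enumeration P
enumerate {zero} P P? = record
  { size = 0 ; element = λ () ; element-valid = λ ()
  ; index = λ () ; element-index = λ () ; index-element = λ () }
enumerate {suc n} P P? with P? zero | enumerate (P ∘ suc) (P? ∘ suc)
... | no ¬p₀ | rest = record
  { size = size ; element = suc ∘ element ; element-valid = element-valid
  ; index = index′ ; element-index = element-index′ ; index-element = index-element }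
  where
  open Enumeration rest
  index′ : ∀ i → P i → Fin size
  index′ zero p = ⊥-elim (¬p₀ p)
  index′ (suc i) p = index i p
  element-index′ : ∀ i p → suc (element (index′ i p)) ≡ i
  element-index′ zero p = ⊥-elim (¬p₀ p)
  element-index′ (suc i) p = ≡.cong suc (element-index i p)
... | yes p₀ | rest = record
  { size = suc size ; element = element′ ; element-valid = element-valid′
  ; index = index′ ; element-index = element-index′ ; index-element = index-element′ }
  where
  open Enumeration rest
  element′ : Fin (suc size) → Fin (suc n)
  element′ zero = zero
  element′ (suc j) = suc (element j)
  element-valid′ : ∀ j → P (element′ j)
  element-valid′ zero = p₀
  element-valid′ (suc j) = element-valid j
  index′ : ∀ i → P i → Fin (suc size)
  index′ zero _ = zero
  index′ (suc i) p = suc (index i p)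
  element-index′ : ∀ i p → element′ (index′ i p) ≡ i
  element-index′ zero _ = ≡.refl
  element-index′ (suc i) p = ≡.cong suc (element-index i p)
  index-element′ : ∀ j p → index′ (element′ j) p ≡ j
  index-element′ zero _ = ≡.refl
  index-element′ (suc j) p = ≡.cong suc (index-element j p)

injective⇒surjective : ∀ {k} (f : Fin k → Fin k) →
  (∀ {a b} → f a ≡ f b → a ≡ b) → ∀ y → ∃ λ x → f x ≡ y
injective⇒surjective {suc k} f f-inj y with any? (λ x → f x ≟ y)
... | yes hit = hit
... | no miss = ⊥-elim (ℕ.<-irrefl ≡.refl (injective⇒≤ g-injective))
  where
  -- Missing y, f factors injectively through Fin k.
  y≢f : ∀ x → y ≢ f x
  y≢f x y≡fx = miss (x , ≡.sym y≡fx)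
  g : Fin (suc k) → Fin k
  g x = punchOut (y≢f x)
  g-injective : ∀ {a b} → g a ≡ g b → a ≡ b
  g-injective {a} {b} eq = f-inj (punchOut-injective (y≢f a) (y≢f b) eq)

-- A fixed-point-free involution on Fin a forces a to be even: the
-- indices i with i < τ i and those with τ i < i are swapped by τ.
involution⇒even : ∀ {a} (τ : Fin a → Fin a) → (∀ i → τ (τ i) ≡ i) →
  (∀ i → τ i ≢ i) → ∃ λ p → a ≡ 2 ℕ.* p
involution⇒even {a} τ τ-involutive τ-fixpointFree = sum below , (begin
  a                               ≡⟨ sum-of-ones a ⟨
  sum {a} (λ _ → 1)               ≡⟨ sum-cong-≗ (λ i → ≡.sym (below+above i)) ⟩
  sum (λ i → below i ℕ.+ above i) ≡⟨ ∑-distrib-+ below above ⟩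
  sum below ℕ.+ sum above         ≡⟨ ≡.cong (sum below ℕ.+_) above-via-τ ⟩
  sum below ℕ.+ sum below         ≡⟨ ≡.cong (sum below ℕ.+_) (ℕ.+-identityʳ (sum below)) ⟨
  2 ℕ.* sum below                 ∎)
  where
  open ≡.≡-Reasoning
  indicator : Bool → ℕ
  indicator b = if b then 1 else 0
  below above : Fin a → ℕ
  below i = indicator (toℕ i <ᵇ toℕ (τ i))
  above i = indicator (toℕ (τ i) <ᵇ toℕ i)

  sum-of-ones : ∀ k → sum {k} (λ _ → 1) ≡ k
  sum-of-ones zero = ≡.refl
  sum-of-ones (suc k) = ≡.cong suc (sum-of-ones k)

  exactly-one : ∀ x y → x ≢ y → indicator (x <ᵇ y) ℕ.+ indicator (y <ᵇ x) ≡ 1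
  exactly-one zero zero x≢y = ⊥-elim (x≢y ≡.refl)
  exactly-one zero (suc y) x≢y = ≡.refl
  exactly-one (suc x) zero x≢y = ≡.refl
  exactly-one (suc x) (suc y) x≢y = exactly-one x y (x≢y ∘ ≡.cong suc)

  below+above : ∀ i → below i ℕ.+ above i ≡ 1
  below+above i = exactly-one (toℕ i) (toℕ (τ i)) (τ-fixpointFree i ∘ ≡.sym ∘ toℕ-injective)

  above-via-τ : sum above ≡ sum below
  above-via-τ = ≡.trans
    (sum-cong-≗ (λ i → ≡.cong (λ j → indicator (toℕ (τ i) <ᵇ toℕ j)) (≡.sym (τ-involutive i))))
    (≡.sym (sum-permute below (permutation τ τ τ-involutive τ-involutive)))

module FiniteSetoid {s e} (S : Setoid s e) {k} (E : Inverse (≡.setoid (Fin k)) S) where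
  open Setoid S
  open Inverse E

  to-injective : ∀ {i j} → to i ≈ to j → i ≡ j
  to-injective {i} {j} eq = ≡.trans (≡.sym (inverseʳ refl)) (inverseʳ eq)

  from-injective : ∀ {x y} → from x ≡ from y → x ≈ y
  from-injective {x} {y} eq = trans (sym (inverseˡ ≡.refl)) (inverseˡ eq)

  injective⇒surjectiveₛ : (f : Carrier → Carrier) → (∀ {x y} → x ≈ y → f x ≈ f y) →
    (∀ {x y} → f x ≈ f y → x ≈ y) → ∀ y → ∃ λ x → f x ≈ y
  injective⇒surjectiveₛ f f-cong f-inj y =
    let (i , hit) = injective⇒surjective (from ∘ f ∘ to) g-injective (from y)
    in to i , from-injective hit
    where
    g-injective : ∀ {i j} → from (f (to i)) ≡ from (f (to j)) → i ≡ j
    g-injective eq = to-injective (f-inj (from-injective eq))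

  involution⇒evenₛ : (σ : Carrier → Carrier) → (∀ {x y} → x ≈ y → σ x ≈ σ y) →
    (∀ x → σ (σ x) ≈ x) → (∀ x → ¬ σ x ≈ x) → ∃ λ p → k ≡ 2 ℕ.* p
  involution⇒evenₛ σ σ-cong σ-involutive σ-fixpointFree =
    involution⇒even τ τ-involutive τ-fixpointFree
    where
    τ : Fin k → Fin k
    τ = from ∘ σ ∘ to
    τ-involutive : ∀ i → τ (τ i) ≡ i
    τ-involutive i = to-injective (trans (inverseˡ ≡.refl)
      (trans (σ-cong (inverseˡ ≡.refl)) (σ-involutive (to i))))
    τ-fixpointFree : ∀ i → τ i ≢ i
    τ-fixpointFree i eq = σ-fixpointFree (to i) (sym (inverseˡ (≡.sym eq)))

card-× : ∀ {a b c s₁ e₁ s₂ e₂ s₃ e₃} {A : Setoid s₁ e₁} {B : Setoid s₂ e₂} {C : Setoid s₃ e₃} →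
  Inverse (≡.setoid (Fin a)) A → Inverse A (B ×ₛ C) →
  Inverse (≡.setoid (Fin b)) B → Inverse (≡.setoid (Fin c)) C → a ≡ b ℕ.* c
card-× FA A≅B×C FB FC = ↔⇒≡
  (Compose.inverse FA (Compose.inverse A≅B×C (Compose.inverse
    (Symmetry.inverse FB ×-inverse Symmetry.inverse FC)
    (Compose.inverse Pointwise-≡↔≡ (Symmetry.inverse *↔×)))))

-- Choosing in each class the element of least
-- index gives a representative function, and the classes form a finite
-- setoid A/~.
module Transversal {s e r} (A : Setoid s e) {n} (E : Inverse (≡.setoid (Fin n)) A)
  (_~_ : Rel (Setoid.Carrier A) r) (~-isEquivalence : IsEquivalence _~_)
  (≈⇒~ : ∀ {x y} → Setoid._≈_ A x y → x ~ y) (_~?_ : Decidable₂ _~_) where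
  open Setoid A
  open Inverse E
  private module ~ = IsEquivalence ~-isEquivalence

  A/~ : Setoid s r
  A/~ = record { Carrier = Carrier ; _≈_ = _~_ ; isEquivalence = ~-isEquivalence }

  canon : Carrier → Fin n
  canon x = fromMaybe (from x) (firstIndex (λ i → to i ~? x))

  rep : Carrier → Carrier
  rep x = to (canon x)

  rep-~ : ∀ x → rep x ~ x
  rep-~ x with firstIndex (λ i → to i ~? x) in eq
  ... | just i = firstIndex-sound (λ i → to i ~? x) i eq
  ... | nothing = ≈⇒~ (inverseˡ ≡.refl)

  canon-cong : ∀ {x y} → x ~ y → canon x ≡ canon y
  canon-cong {x} {y} x~y
    with j , eq ← firstIndex-complete (λ i → to i ~? x) (from x) (≈⇒~ (inverseˡ ≡.refl)) =
    ≡.trans (≡.cong (fromMaybe (from x)) eq)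
            (≡.cong (fromMaybe (from y)) (≡.trans (≡.sym eq) same-first))
    where
    same-first : firstIndex (λ i → to i ~? x) ≡ firstIndex (λ i → to i ~? y)
    same-first = firstIndex-cong (λ i → to i ~? x) (λ i → to i ~? y)
      (λ i p → ~.trans p x~y) (λ i p → ~.trans p (~.sym x~y))

  rep-cong : ∀ {x y} → x ~ y → rep x ≈ rep y
  rep-cong x~y = to-cong (canon-cong x~y)

  -- The quotient is finite: its classes correspond to the canonical indices.
  private
    IsCanonical : Fin n → Set
    IsCanonical i = canon (to i) ≡ i

    canonical : Enumeration IsCanonical
    canonical = enumerate IsCanonical (λ i → canon (to i) ≟ i)
    module C = Enumeration canonical

    canon-canonical : ∀ x → IsCanonical (canon x)
    canon-canonical x = canon-cong (rep-~ x)

  quotientSize : ℕ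
  quotientSize = C.size

  quotientFinite : Inverse (≡.setoid (Fin quotientSize)) A/~
  quotientFinite = record
    { to = λ j → to (C.element j)
    ; from = λ x → C.index (canon x) (canon-canonical x)
    ; to-cong = λ { ≡.refl → ~.refl }
    ; from-cong = λ {x} {y} x~y → C.index-unique (canon x) _ _
        (≡.trans (canon-cong x~y) (≡.sym (C.element-index (canon y) (canon-canonical y))))
    ; inverse = (λ { {x} ≡.refl → ≡.subst (λ i → to i ~ x)
                       (≡.sym (C.element-index (canon x) (canon-canonical x))) (rep-~ x) })
              , (λ {j} {y} y~ → C.index-unique (canon y) j _
                       (≡.trans (canon-cong y~) (C.element-valid j))) }

-- The notion of maximal ideal is stated for all predicates in Set ℓ, so a
-- maximal ideal M decides every proposition P : Set ℓ: the ideal M ∪ {x ∣ P}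
-- contains M, hence is either M itself (so ¬ P) or everything (so P).
module _ {c ℓ} (R : CommutativeRing c ℓ) {M : CommutativeRing.Carrier R → Set ℓ}
         (maximal : IsMaximalIdeal R M) where
  open CommutativeRing R
  private
    module M = IsIdeal (proj₁ maximal)

    M∪ : Set ℓ → Carrier → Set ℓ
    M∪ P x = M x ⊎ P

    M∪-ideal : ∀ P → IsIdeal R (M∪ P)
    M∪-ideal P = record
      { resp = λ eq → Sum.map₁ (M.resp eq)
      ; zero∈ = inj₁ M.zero∈
      ; +-closed = λ { (inj₁ a) (inj₁ b) → inj₁ (M.+-closed a b) ; (inj₂ p) _ → inj₂ p ; _ (inj₂ p) → inj₂ p }
      ; neg-closed = Sum.map₁ M.neg-closed
      ; *-closed = λ r → Sum.map₁ (M.*-closed r) }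

  excludedMiddle : (P : Set ℓ) → P ⊎ ¬ P
  excludedMiddle P with proj₂ (proj₂ maximal) (M∪ P) (M∪-ideal P) (λ _ → inj₁)
  ... | inj₁ M∪P⊆M = inj₂ (λ p → proj₁ (proj₂ maximal) (M∪P⊆M 1# (inj₂ p)))
  ... | inj₂ M∪P=R = Sum.[ ⊥-elim ∘ proj₁ (proj₂ maximal) , inj₁ ] (M∪P=R 1#)

module FiniteRingIdeals {c ℓ} (R : CommutativeRing c ℓ) {n} (E : HasCard R n) where
  open CommutativeRing R hiding (zero)
  open CommutativeRingSolver R
  private module E = Inverse E

  Pred : Set (c ⊔ Level.suc ℓ)
  Pred = Carrier → Set ℓ

  _⊆_ : Pred → Pred → Set (c ⊔ ℓ)
  I ⊆ J = ∀ x → I x → J x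

  -- The ideal I + Rx.  The coefficient ranges over the indices of R
  -- rather than over R itself, which keeps the predicate in Set ℓ.
  _+⟨_⟩ : Pred → Carrier → Pred
  (I +⟨ x ⟩) y = ∃ λ (i : Fin n) → I (y - E.to i * x)

  private
    coefficient : ∀ a → E.to (E.from a) ≈ a
    coefficient a = E.inverseˡ ≡.refl

    minus-multiple : ∀ y x a → y - E.to (E.from a) * x ≈ y - a * x
    minus-multiple y x a = +-congˡ (-‿cong (*-congʳ (coefficient a)))

  module _ {I : Pred} (I-ideal : IsIdeal R I) (x : Carrier) where
    private module I = IsIdeal I-ideal

    +⟨⟩-ideal : IsIdeal R (I +⟨ x ⟩)
    +⟨⟩-ideal = record
      { resp = λ { eq (i , p) → i , I.resp (+-congʳ eq) p }
      ; zero∈ = E.from 0# , I.resp (sym (trans (minus-multiple 0# x 0#)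
          (solve 1 (λ x → con (0 , 0) :- con (0 , 0) :* x := con (0 , 0)) refl x))) I.zero∈
      ; +-closed = λ { {y} {y′} (i , p) (j , q) → E.from (E.to i + E.to j) ,
          I.resp (trans (solve 5 (λ y y′ a b x → (y :- a :* x) :+ (y′ :- b :* x) := (y :+ y′) :- (a :+ b) :* x)
                                 refl y y′ (E.to i) (E.to j) x)
                        (sym (minus-multiple _ x _)))
                 (I.+-closed p q) }
      ; neg-closed = λ { {y} (i , p) → E.from (- E.to i) ,
          I.resp (trans (solve 3 (λ y a x → :- (y :- a :* x) := (:- y) :- (:- a) :* x) refl y (E.to i) x)
                        (sym (minus-multiple _ x _)))
                 (I.neg-closed p) }
      ; *-closed = λ r → λ { {y} (i , p) → E.from (r * E.to i) ,
          I.resp (trans (solve 4 (λ r y a x → r :* (y :- a :* x) := r :* y :- (r :* a) :* x) refl r y (E.to i) x)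
                        (sym (minus-multiple _ x _)))
                 (I.*-closed r p) } }

    ⊆+⟨⟩ : I ⊆ (I +⟨ x ⟩)
    ⊆+⟨⟩ y p = E.from 0# , I.resp (sym (trans (minus-multiple y x 0#)
      (solve 2 (λ y x → y :- con (0 , 0) :* x := y) refl y x))) p

    ∈+⟨⟩ : (I +⟨ x ⟩) x
    ∈+⟨⟩ = E.from 1# , I.resp (sym (trans (minus-multiple x x 1#)
      (solve 1 (λ x → x :- con (1 , 0) :* x := con (0 , 0)) refl x))) I.zero∈

  +⟨⟩-least : ∀ {I J : Pred} {x} → IsIdeal R J → I ⊆ J → J x → (I +⟨ x ⟩) ⊆ J
  +⟨⟩-least {x = x} J-ideal I⊆J x∈J y (i , p) =
    J.resp (solve 3 (λ y a x → (y :- a :* x) :+ a :* x := y) refl y (E.to i) x)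
           (J.+-closed (I⊆J _ p) (J.*-closed (E.to i) x∈J))
    where module J = IsIdeal J-ideal

  -- Run through the elements of R once, adjoining
  -- each one whose adjunction keeps the ideal proper; the result is maximal.
  module _ (lem : (P : Set ℓ) → P ⊎ ¬ P) where

    grow : Pred → Carrier → Pred
    grow I x with lem ((I +⟨ x ⟩) 1#)
    ... | inj₁ _ = I
    ... | inj₂ _ = I +⟨ x ⟩

    module _ {I : Pred} (I-ideal : IsIdeal R I) (x : Carrier) where
      grow-ideal : IsIdeal R (grow I x)
      grow-ideal with lem ((I +⟨ x ⟩) 1#)
      ... | inj₁ _ = I-ideal
      ... | inj₂ _ = +⟨⟩-ideal I-ideal x

      grow-proper : ¬ I 1# → ¬ grow I x 1#
      grow-proper 1∉I with lem ((I +⟨ x ⟩) 1#)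
      ... | inj₁ _ = 1∉I
      ... | inj₂ 1∉I+Rx = 1∉I+Rx

      ⊆grow : I ⊆ grow I x
      ⊆grow with lem ((I +⟨ x ⟩) 1#)
      ... | inj₁ _ = λ _ → id
      ... | inj₂ _ = ⊆+⟨⟩ I-ideal x

      grow-settles : grow I x x ⊎ (∀ J → IsIdeal R J → I ⊆ J → J x → J 1#)
      grow-settles with lem ((I +⟨ x ⟩) 1#)
      ... | inj₁ 1∈I+Rx = inj₂ (λ J J-ideal I⊆J x∈J → +⟨⟩-least J-ideal I⊆J x∈J 1# 1∈I+Rx)
      ... | inj₂ _ = inj₁ (∈+⟨⟩ I-ideal x)

    saturate : ∀ {k} → Pred → (Fin k → Carrier) → Pred
    saturate {zero} I xs = I
    saturate {suc k} I xs = saturate (grow I (xs zero)) (xs ∘ suc)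

    ⊆-trans : ∀ {I J K : Pred} → I ⊆ J → J ⊆ K → I ⊆ K
    ⊆-trans I⊆J J⊆K x = J⊆K x ∘ I⊆J x

    saturate-ideal : ∀ {k I} → IsIdeal R I → (xs : Fin k → Carrier) → IsIdeal R (saturate I xs)
    saturate-ideal {zero} I-ideal xs = I-ideal
    saturate-ideal {suc k} I-ideal xs = saturate-ideal (grow-ideal I-ideal (xs zero)) (xs ∘ suc)

    saturate-proper : ∀ {k I} → IsIdeal R I → (xs : Fin k → Carrier) → ¬ I 1# → ¬ saturate I xs 1#
    saturate-proper {zero} I-ideal xs 1∉I = 1∉I
    saturate-proper {suc k} I-ideal xs 1∉I =
      saturate-proper (grow-ideal I-ideal (xs zero)) (xs ∘ suc) (grow-proper I-ideal (xs zero) 1∉I)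

    ⊆saturate : ∀ {k I} → IsIdeal R I → (xs : Fin k → Carrier) → I ⊆ saturate I xs
    ⊆saturate {zero} I-ideal xs = λ _ → id
    ⊆saturate {suc k} I-ideal xs =
      ⊆-trans (⊆grow I-ideal (xs zero)) (⊆saturate (grow-ideal I-ideal (xs zero)) (xs ∘ suc))

    saturate-settles : ∀ {k I} → IsIdeal R I → (xs : Fin k → Carrier) → ∀ j →
      saturate I xs (xs j) ⊎ (∀ J → IsIdeal R J → saturate I xs ⊆ J → J (xs j) → J 1#)
    saturate-settles {suc k} I-ideal xs zero with grow-settles I-ideal (xs zero)
    ... | inj₁ adjoined = inj₁ (⊆saturate (grow-ideal I-ideal (xs zero)) (xs ∘ suc) (xs zero) adjoined)
    ... | inj₂ generates = inj₂ λ J J-ideal sat⊆J x∈J → generates J J-ideal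
      (⊆-trans (⊆-trans (⊆grow I-ideal (xs zero)) (⊆saturate (grow-ideal I-ideal (xs zero)) (xs ∘ suc))) sat⊆J)
      x∈J
    saturate-settles {suc k} I-ideal xs (suc j) =
      saturate-settles (grow-ideal I-ideal (xs zero)) (xs ∘ suc) j

    maximal-above : ∀ {I} → IsIdeal R I → ¬ I 1# → Σ Pred λ J → IsMaximalIdeal R J × I ⊆ J
    maximal-above {I} I-ideal 1∉I =
      J , (J-ideal , saturate-proper I-ideal E.to 1∉I , J-maximal) , ⊆saturate I-ideal E.to
      where
      J : Pred
      J = saturate I E.to
      J-ideal : IsIdeal R J
      J-ideal = saturate-ideal I-ideal E.to
      module J = IsIdeal J-ideal
      J-maximal : ∀ K → IsIdeal R K → J ⊆ K → K ⊆ J ⊎ (∀ x → K x)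
      J-maximal K K-ideal J⊆K with lem (∃ λ i → K (E.to i) × ¬ J (E.to i))
      ... | inj₁ (i , i∈K , i∉J) with saturate-settles I-ideal E.to i
      ...   | inj₁ i∈J = ⊥-elim (i∉J i∈J)
      ...   | inj₂ generates = inj₂ λ x → K.resp (*-identityʳ x) (K.*-closed x (generates K K-ideal J⊆K i∈K))
        where module K = IsIdeal K-ideal
      J-maximal K K-ideal J⊆K | inj₂ no-witness = inj₁ K⊆J
        where
        K⊆J : K ⊆ J
        K⊆J x x∈K with lem (J x)
        ... | inj₁ x∈J = x∈J
        ... | inj₂ x∉J = ⊥-elim (no-witness
          (E.from x , IsIdeal.resp K-ideal (sym (coefficient x)) x∈K , x∉J ∘ J.resp (coefficient x)))

module _ {c ℓ} (R : CommutativeRing c ℓ) where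
  open CommutativeRing R
  import Algebra.Properties.Ring ring as RingProps

  zeroIdeal : IsIdeal R (λ y → y ≈ 0#)
  zeroIdeal = record
    { resp = λ x≈y x≈0 → trans (sym x≈y) x≈0
    ; zero∈ = refl
    ; +-closed = λ x≈0 y≈0 → trans (+-cong x≈0 y≈0) (+-identityʳ 0#)
    ; neg-closed = λ x≈0 → trans (-‿cong x≈0) RingProps.-0#≈0#
    ; *-closed = λ r x≈0 → trans (*-congˡ x≈0) (zeroʳ r) }

module FiniteLocalRing {c ℓ} (R : CommutativeRing c ℓ) {M : CommutativeRing.Carrier R → Set ℓ}
                       (local : IsLocalWithMaximal R M) {n} (E : HasCard R n) where
  open CommutativeRing R hiding (zero)
  open FiniteRingIdeals R E
  open import Algebra.Properties.Group +-group using (x∙y⁻¹≈ε⇒x≈y)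

  lem : (P : Set ℓ) → P ⊎ ¬ P
  lem = excludedMiddle R (proj₁ local)

  -- Every element outside M is a unit: otherwise Rr is proper, hence lies
  -- in a maximal ideal, which must be M.
  nonmember⇒unit : ∀ r → ¬ M r → IsUnit R r
  nonmember⇒unit r r∉M with lem (((λ y → y ≈ 0#) +⟨ r ⟩) 1#)
  ... | inj₁ (i , 1-ir≈0) = Inverse.to E i , trans (*-comm r _) (sym (x∙y⁻¹≈ε⇒x≈y 1# _ 1-ir≈0))
  ... | inj₂ 1∉Rr with maximal-above lem (+⟨⟩-ideal (zeroIdeal R) r) 1∉Rr
  ...   | J , J-maximal , Rr⊆J =
    ⊥-elim (r∉M (Equivalence.to (proj₂ local J J-maximal r) (Rr⊆J r (∈+⟨⟩ (zeroIdeal R) r))))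

  M-ideal : IsIdeal R M
  M-ideal = proj₁ (proj₁ local)

  1∉M : ¬ M 1#
  1∉M = proj₁ (proj₂ (proj₁ local))

  private module M = IsIdeal M-ideal
  open Quotient R M M-ideal using (_∼_; R/M; lift; ∼-trans; *-cong∼; neg-cong∼)
  open CommutativeRingSolver R
  open import Relation.Binary.Reasoning.Setoid setoid

  M-difference : ∀ {a b} → M a → M b → M (a - b)
  M-difference a∈M b∈M = M.+-closed a∈M (M.neg-closed b∈M)

  unit-* : ∀ {a b} → IsUnit R a → IsUnit R b → IsUnit R (a * b)
  unit-* {a} {b} (a′ , aa′≈1) (b′ , bb′≈1) = a′ * b′ , (begin
    (a * b) * (a′ * b′) ≈⟨ solve 4 (λ a b a′ b′ → (a :* b) :* (a′ :* b′) := (a :* a′) :* (b :* b′)) refl a b a′ b′ ⟩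
    (a * a′) * (b * b′) ≈⟨ *-cong aa′≈1 bb′≈1 ⟩
    1# * 1#             ≈⟨ *-identityʳ 1# ⟩
    1#                  ∎)

  unit-mod⇒unit : ∀ {u w} → (u * w) ∼ 1# → IsUnit R u
  unit-mod⇒unit {u} {w} uw∼1 = nonmember⇒unit u λ u∈M → 1∉M
    (M.resp (solve 2 (λ x o → x :- (x :- o) := o) refl (u * w) 1#)
            (M-difference (M.resp (*-comm w u) (M.*-closed w u∈M)) uw∼1))

  one-plus-unit : ∀ {s} → M s → IsUnit R (1# + s)
  one-plus-unit {s} s∈M = nonmember⇒unit (1# + s) λ 1+s∈M → 1∉M
    (M.resp (solve 2 (λ o s → (o :+ s) :- s := o) refl 1# s) (M-difference 1+s∈M s∈M))

  -- Hensel-type lifting of squares, valid when 2 ∉ M.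
  module SquareLifting {m} (EM : SubsetHasCard R M m) (2∉M : ¬ M (1# + 1#)) where
    open import Algebra.Properties.Group +-group using (x≈y⇒x∙y⁻¹≈ε)

    -- g s = (1 + s)² - 1
    g : Carrier → Carrier
    g s = s + s + s * s

    g-cong : ∀ {s t} → s ≈ t → g s ≈ g t
    g-cong s≈t = +-cong (+-cong s≈t s≈t) (*-cong s≈t s≈t)

    -- g is injective on M: g s - g t = (s - t)(2 + s + t), and 2 + s + t
    -- is a unit because 2 ∉ M.
    g-injective : ∀ {s t} → M s → M t → g s ≈ g t → s ≈ t
    g-injective {s} {t} s∈M t∈M gs≈gt = x∙y⁻¹≈ε⇒x≈y s t (begin
      s - t               ≈⟨ *-identityʳ (s - t) ⟨
      (s - t) * 1#        ≈⟨ *-congˡ dd′≈1 ⟨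
      (s - t) * (d * d′)  ≈⟨ *-assoc (s - t) d d′ ⟨
      ((s - t) * d) * d′  ≈⟨ *-congʳ factorisation ⟨
      (g s - g t) * d′    ≈⟨ *-congʳ (x≈y⇒x∙y⁻¹≈ε gs≈gt) ⟩
      0# * d′             ≈⟨ zeroˡ d′ ⟩
      0#                  ∎)
      where
      d : Carrier
      d = (1# + 1#) + s + t
      factorisation : g s - g t ≈ (s - t) * d
      factorisation = solve 2 (λ s t → (s :+ s :+ s :* s) :- (t :+ t :+ t :* t)
                                     := (s :- t) :* (con (2 , 0) :+ s :+ t)) refl s t
      d∉M : ¬ M d
      d∉M d∈M = 2∉M (M.resp (solve 3 (λ two s t → two :+ s :+ t :- s :- t := two) refl (1# + 1#) s t)
                            (M-difference (M-difference d∈M s∈M) t∈M))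
      d′ : Carrier
      d′ = proj₁ (nonmember⇒unit d d∉M)
      dd′≈1 : d * d′ ≈ 1#
      dd′≈1 = proj₂ (nonmember⇒unit d d∉M)

    -- Hence, M being finite, g maps M onto M.
    g-surjective : ∀ {t} → M t → ∃ λ s → M s × g s ≈ t
    g-surjective {t} t∈M =
      let ((s , s∈M) , gs≈t) = FiniteSetoid.injective⇒surjectiveₛ (SubSetoid R M) EM gₘ g-cong
                                 (λ {(s , s∈M)} {(t , t∈M)} → g-injective s∈M t∈M) (t , t∈M)
      in s , s∈M , gs≈t
      where
      gₘ : Σ Carrier M → Σ Carrier M
      gₘ (s , s∈M) = g s , M.+-closed (M.+-closed s∈M s∈M) (M.*-closed s s∈M)

    lift-square : ∀ {a u} → IsUnit R u → a ∼ (u * u) → ∃ λ v → IsUnit R v × a ≈ v * v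
    lift-square {a} {u} (w , uw≈1) a∼u² =
      u * (1# + s) , unit-* (w , uw≈1) (one-plus-unit s∈M) , sym (begin
        (u * (1# + s)) * (u * (1# + s))   ≈⟨ solve 2 (λ u s → (u :* (con (1 , 0) :+ s)) :* (u :* (con (1 , 0) :+ s))
                                                          := (u :* u) :* (con (1 , 0) :+ (s :+ s :+ s :* s))) refl u s ⟩
        (u * u) * (1# + g s)              ≈⟨ *-congˡ (+-congˡ gs≈b-1) ⟩
        (u * u) * (1# + (b - 1#))         ≈⟨ solve 4 (λ u a w o → (u :* u) :* (o :+ (a :* (w :* w) :- o))
                                                          := a :* ((u :* w) :* (u :* w))) refl u a w 1# ⟩
        a * ((u * w) * (u * w))           ≈⟨ *-congˡ (trans (*-cong uw≈1 uw≈1) (*-identityʳ 1#)) ⟩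
        a * 1#                            ≈⟨ *-identityʳ a ⟩
        a                                 ∎)
      where
      -- b = a w² is congruent to 1 modulo M, so b = (1 + s)² with s ∈ M.
      b : Carrier
      b = a * (w * w)
      b∼1 : b ∼ 1#
      b∼1 = ∼-trans (*-cong∼ a∼u² (lift refl))
        (lift (trans (solve 2 (λ u w → (u :* u) :* (w :* w) := (u :* w) :* (u :* w)) refl u w)
                     (trans (*-cong uw≈1 uw≈1) (*-identityʳ 1#))))
      s : Carrier
      s = proj₁ (g-surjective b∼1)
      s∈M : M s
      s∈M = proj₁ (proj₂ (g-surjective b∼1))
      gs≈b-1 : g s ≈ b - 1#
      gs≈b-1 = proj₂ (proj₂ (g-surjective b∼1))

    InT-lift : ∀ z → InT R/M z → InT R z
    InT-lift z (u , (w , uw∼1) , inj₁ z∼u²) =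
      let (v , v-unit , z≈v²) = lift-square (unit-mod⇒unit uw∼1) z∼u² in v , v-unit , inj₁ z≈v²
    InT-lift z (u , (w , uw∼1) , inj₂ z∼-u²) =
      let (v , v-unit , -z≈v²) = lift-square (unit-mod⇒unit uw∼1) -z∼u² in v , v-unit , inj₂ (begin
        z       ≈⟨ solve 1 (λ z → z := :- (:- z)) refl z ⟩
        - (- z) ≈⟨ -‿cong -z≈v² ⟩
        - (v * v) ∎)
      where
      -z∼u² : (- z) ∼ (u * u)
      -z∼u² = ∼-trans (neg-cong∼ z∼-u²) (lift (solve 1 (λ x → :- (:- x) := x) refl (u * u)))

module LocalRingGraph {c ℓ} (R : CommutativeRing c ℓ) {M : CommutativeRing.Carrier R → Set ℓ}
  (local : IsLocalWithMaximal R M) {n m} (E : HasCard R n) (EM : SubsetHasCard R M m) where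
  open CommutativeRing R
  open CommutativeRingSolver R
  open FiniteLocalRing R local E
  open Quotient R M M-ideal using (_∼_; R/M; lift; ∼-sym; +-cong∼)
  open Transversal setoid E _∼_ (CommutativeRing.isEquivalence R/M) lift (λ x y → fromSum (lem (x ∼ y)))
  private
    module M = IsIdeal M-ideal
    module EM = Inverse EM

  open import Relation.Binary.Reasoning.Setoid setoid

  offset : Carrier → Σ Carrier M
  offset x = x - rep x , ∼-sym (rep-~ x)

  element : Fin m → Carrier
  element l = proj₁ (EM.to l)

  decomposition : Inverse setoid (CommutativeRing.setoid R/M ×ₛ ≡.setoid (Fin m))
  decomposition = record
    { to = λ x → x , EM.from (offset x)
    ; from = λ (y , l) → rep y + element l
    ; to-cong = λ x≈y → lift x≈y , EM.from-cong (+-cong x≈y (-‿cong (rep-cong (lift x≈y))))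
    ; from-cong = λ { (y∼y′ , ≡.refl) → +-congʳ (rep-cong y∼y′) }
    ; inverse = (λ {yl} {x} → split-recovers yl x) , (λ {x} {yl} → recombine x yl)
    }
    where
    x∼y : ∀ y l x → x ≈ rep y + element l → x ∼ y
    x∼y y l x x≈ = M.resp (sym (begin
      x - y                   ≈⟨ +-congʳ x≈ ⟩
      (rep y + element l) - y ≈⟨ solve 3 (λ r t y → (r :+ t) :- y := (r :- y) :+ t) refl (rep y) (element l) y ⟩
      (rep y - y) + element l ∎))
      (M.+-closed (rep-~ y) (proj₂ (EM.to l)))
    offset≈ : ∀ y l x → x ≈ rep y + element l → x - rep x ≈ element l
    offset≈ y l x x≈ = begin
      x - rep x                     ≈⟨ +-cong x≈ (-‿cong (rep-cong (x∼y y l x x≈))) ⟩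
      (rep y + element l) - rep y   ≈⟨ solve 2 (λ r t → (r :+ t) :- r := t) refl (rep y) (element l) ⟩
      element l                     ∎
    split-recovers : ∀ yl x → x ≈ rep (proj₁ yl) + element (proj₂ yl) →
      (x ∼ proj₁ yl) × (EM.from (offset x) ≡ proj₂ yl)
    split-recovers (y , l) x x≈ = x∼y y l x x≈ , EM.inverseʳ (offset≈ y l x x≈)
    recombine : ∀ x yl → (proj₁ yl ∼ x) × (proj₂ yl ≡ EM.from (offset x)) →
      rep (proj₁ yl) + element (proj₂ yl) ≈ x
    recombine x (y , l) (y∼x , ≡.refl) = begin
      rep y + element (EM.from (offset x)) ≈⟨ +-cong (rep-cong y∼x) (EM.inverseˡ ≡.refl) ⟩
      rep x + (x - rep x)                  ≈⟨ solve 2 (λ r x → r :+ (x :- r) := x) refl (rep x) x ⟩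
      x                                    ∎

  InT-reduce : ∀ z → InT R z → InT R/M z
  InT-reduce z (u , (w , uw≈1) , inj₁ z≈u²) = u , (w , lift uw≈1) , inj₁ (lift z≈u²)
  InT-reduce z (u , (w , uw≈1) , inj₂ z≈-u²) = u , (w , lift uw≈1) , inj₂ (lift z≈-u²)

  -- When 2 ∉ M, x - y ∈ T_R iff x - y ∈ T_{R/M}, so the decomposition is
  -- a graph isomorphism.
  isomorphism : ¬ M (1# + 1#) → QUCG R ≅ (QUCG R/M ⊗ K̊ m)
  isomorphism 2∉M = decomposition , λ x y →
    mk⇔ (λ x-y∈T → InT-reduce (x - y) x-y∈T , _) (λ (x-y∈T , _) → InT-lift (x - y) x-y∈T)
    where open SquareLifting EM 2∉M

  size-product : n ≡ quotientSize ℕ.* m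
  size-product = card-× E decomposition quotientFinite (Identity.inverse (≡.setoid (Fin m)))

  -- If 2 ∈ M, then x ↦ x + 1 is a fixed-point-free involution of R/M, so
  -- |R/M| is even.
  2∈M⇒even : M (1# + 1#) → ∃ λ p → quotientSize ≡ 2 ℕ.* p
  2∈M⇒even 2∈M = FiniteSetoid.involution⇒evenₛ A/~ quotientFinite (_+ 1#)
    (λ x∼y → +-cong∼ x∼y (lift refl))
    (λ x → M.resp (sym (solve 1 (λ x → (x :+ con (1 , 0)) :+ con (1 , 0) :- x := con (2 , 0)) refl x)) 2∈M)
    (λ x x+1∼x → 1∉M (M.resp (solve 1 (λ x → (x :+ con (1 , 0)) :- x := con (1 , 0)) refl x) x+1∼x))

  odd⇒2∉M : ∀ k → n ≡ k ℕ.* m → Odd k → ¬ M (1# + 1#)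
  odd⇒2∉M k n≡km (j , k≡1+2j) 2∈M =
    let (p , size≡2p) = 2∈M⇒even 2∈M
    in ℕ.even≢odd p j (≡.trans (≡.sym size≡2p) (≡.trans size≡k k≡1+2j))
    where
    instance
      m-nonZero : ℕ.NonZero m
      m-nonZero = nonZeroIndex (EM.from (0# , M.zero∈))
    size≡k : quotientSize ≡ k
    size≡k = ℕ.*-cancelʳ-≡ quotientSize k m (≡.trans (≡.sym size-product) n≡km)

theorem2p3 : ∀ {c ℓ} (R : CommutativeRing c ℓ)
  (M : CommutativeRing.Carrier R → Set ℓ)
  (local : IsLocalWithMaximal R M)
  (n m : ℕ) → HasCard R n → SubsetHasCard R M m →
  (∃ λ k → n ≡ k ℕ.* m × Odd k) →
  QUCG R ≅ (QUCG (Quotient.R/M R M (proj₁ (proj₁ local))) ⊗ K̊ m)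
theorem2p3 R M local n m E EM (k , n≡km , k-odd) =
  isomorphism (odd⇒2∉M k n≡km k-odd)
  where open LocalRingGraph R local E EM
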